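{- Let $I \subseteq \mathbb{N}$ be a finite set partitioned as $I = B \cup T$ (with $B \cap T = \emptyset$). If $|\mathcal{S}(B)| \cdot |\mathcal{S}(T)| > \Sigma(B) + \Sigma(T) + 1$, then there exist disjoint sets $X,Y \subseteq I$ with $\Sigma(X) = \Sigma(Y)$ and $(X \cup Y) \cap T \neq \emptyset$.
   Context: $\Sigma(Z)$ is the sum of the elements of $Z$. $\mathcal{S}(Z) := \{\Sigma(W) \mid W \subseteq Z\}$ is the set (not multiset) of all subset sums of $Z$. -}

module Defs where

open import Data.Nat using (ℕ; _≟_)
open import Data.Nat.ListAction using (sum)
open import Data.List using (List; []; _∷_; _++_; map; length; deduplicate)

-- A finite set Z ⊆ ℕ is represented by a duplicate-free list (Unique).
-- Σ(Z) is `sum Z` (independent of order).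

sublists : List ℕ → List (List ℕ)
sublists [] = [] ∷ []
sublists (x ∷ xs) = sublists xs ++ map (x ∷_) (sublists xs)

subsetSums : List ℕ → List ℕ
subsetSums Z = deduplicate _≟_ (map sum (sublists Z))

card𝒮 : List ℕ → ℕ
card𝒮 Z = length (subsetSums Z)

{-# OPTIONS --safe #-}
-- The |𝒮(B)|·|𝒮(T)| sums a + b with a ∈ 𝒮(B), b ∈ 𝒮(T) all lie in [0, ΣB + ΣT], so by
-- pigeonhole two of them coincide; their T-parts differ, since equal a and equal a + b would
-- force equal b. Realising the four subset sums by subsets B₁, B₂ ⊆ B and T₁, T₂ ⊆ T gives
-- Σ(B₁ ∪ T₁) = Σ(B₂ ∪ T₂); discarding the common part leaves disjoint X, Y ⊆ B ∪ T with
-- Σ X = Σ Y, and T₁ ≠ T₂ leaves an element of T in X ∪ Y.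
module Submission where

open import Defs
open import Data.Nat using (ℕ; suc; _+_; _*_; _>_; _≤_; _<_; z≤n; s≤s; _≟_)
open import Data.Nat.Properties using (+-mono-≤; +-monoʳ-≤; m≤n+m; ≤-trans; +-comm; +-assoc; +-cancelʳ-≡)
open import Data.Nat.ListAction using (sum)
open import Data.Nat.ListAction.Properties using (sum-++)
open import Data.Bool using (Bool; true; false; _∧_; not)
open import Data.Bool.Properties using (∧-comm)
open import Data.List using (List; []; _∷_; _++_; map; length; lookup)
open import Data.List.Membership.Propositional using (_∈_)
open import Data.List.Membership.Propositional.Properties
  using (∈-lookup; ∈-map⁻; ∈-++⁻; ∈-++⁺ʳ; ∈-deduplicate⁻)
open import Data.List.Relation.Unary.Any using (here; there)
open import Data.List.Relation.Unary.All as All using (All; []; _∷_)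
import Data.List.Relation.Unary.All.Properties as All
open import Data.List.Relation.Unary.AllPairs using ([]; _∷_)
open import Data.List.Relation.Unary.Unique.Propositional using (Unique)
import Data.List.Relation.Unary.Unique.Propositional.Properties as Unique
open import Data.List.Relation.Unary.Unique.DecPropositional.Properties _≟_ using (deduplicate-!)
open import Data.List.Relation.Binary.Subset.Propositional using (_⊆_)
open import Data.List.Relation.Binary.Disjoint.Propositional using (Disjoint)
open import Data.Fin using (Fin; zero; suc; toℕ; fromℕ<; remQuot; combine)
import Data.Fin.Properties as Fin
open import Data.Product as Product using (_×_; _,_; proj₁; proj₂; ∃-syntax; uncurry)
open import Data.Sum as Sum using (_⊎_; inj₁; inj₂)
open import Data.Empty using (⊥-elim)
open import Relation.Binary.PropositionalEquality
  using (_≡_; _≢_; refl; sym; trans; cong; cong₂; subst; module ≡-Reasoning)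

module _ {a} {A : Set a} where

  Mask : List A → Set a
  Mask = All (λ _ → Bool)

  sel : (xs : List A) → Mask xs → List A
  sel []       []          = []
  sel (x ∷ xs) (true  ∷ m) = x ∷ sel xs m
  sel (x ∷ xs) (false ∷ m) = sel xs m

  _∖ᵐ_ _∩ᵐ_ : ∀ {xs} → Mask xs → Mask xs → Mask xs
  []      ∖ᵐ []       = []
  (b ∷ m) ∖ᵐ (c ∷ m′) = (b ∧ not c) ∷ (m ∖ᵐ m′)
  []      ∩ᵐ []       = []
  (b ∷ m) ∩ᵐ (c ∷ m′) = (b ∧ c) ∷ (m ∩ᵐ m′)

  ∩ᵐ-comm : ∀ {xs} (m m′ : Mask xs) → m ∩ᵐ m′ ≡ m′ ∩ᵐ m
  ∩ᵐ-comm []      []       = refl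
  ∩ᵐ-comm (b ∷ m) (c ∷ m′) = cong₂ _∷_ (∧-comm b c) (∩ᵐ-comm m m′)

  ∖ᵐ-++ : ∀ {xs ys} (m₁ m₂ : Mask xs) (n₁ n₂ : Mask ys) →
          All.++⁺ m₁ n₁ ∖ᵐ All.++⁺ m₂ n₂ ≡ All.++⁺ (m₁ ∖ᵐ m₂) (n₁ ∖ᵐ n₂)
  ∖ᵐ-++ []       []       n₁ n₂ = refl
  ∖ᵐ-++ (b ∷ m₁) (c ∷ m₂) n₁ n₂ = cong (_ ∷_) (∖ᵐ-++ m₁ m₂ n₁ n₂)

  sel-++ : ∀ xs {ys} (m : Mask xs) (n : Mask ys) → sel (xs ++ ys) (All.++⁺ m n) ≡ sel xs m ++ sel ys n
  sel-++ []       []          n = refl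
  sel-++ (x ∷ xs) (true  ∷ m) n = cong (x ∷_) (sel-++ xs m n)
  sel-++ (x ∷ xs) (false ∷ m) n = sel-++ xs m n

  ∈-sel-∖ᵐ-++⁺ʳ : ∀ xs {ys} (m₁ m₂ : Mask xs) (n₁ n₂ : Mask ys) →
                  sel ys (n₁ ∖ᵐ n₂) ⊆ sel (xs ++ ys) (All.++⁺ m₁ n₁ ∖ᵐ All.++⁺ m₂ n₂)
  ∈-sel-∖ᵐ-++⁺ʳ xs m₁ m₂ n₁ n₂ p rewrite ∖ᵐ-++ m₁ m₂ n₁ n₂ | sel-++ xs (m₁ ∖ᵐ m₂) (n₁ ∖ᵐ n₂) =
    ∈-++⁺ʳ _ p

  sel-⊆ : ∀ xs (m : Mask xs) → sel xs m ⊆ xs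
  sel-⊆ (x ∷ xs) (true  ∷ m) (here eq) = here eq
  sel-⊆ (x ∷ xs) (true  ∷ m) (there p) = there (sel-⊆ xs m p)
  sel-⊆ (x ∷ xs) (false ∷ m) p         = there (sel-⊆ xs m p)

  sel-unique : ∀ {xs} (m : Mask xs) → Unique xs → Unique (sel xs m)
  sel-unique []          []        = []
  sel-unique (true  ∷ m) (x∉ ∷ u) = All.tabulate (λ y∈ → All.lookup x∉ (sel-⊆ _ m y∈)) ∷ sel-unique m u
  sel-unique (false ∷ m) (_  ∷ u) = sel-unique m u

  sel-∖ᵐ-disjoint : ∀ {xs} (m m′ : Mask xs) → Unique xs → Disjoint (sel xs (m ∖ᵐ m′)) (sel xs (m′ ∖ᵐ m))
  sel-∖ᵐ-disjoint []          []           []       ()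
  sel-∖ᵐ-disjoint (true  ∷ m) (true  ∷ m′) (_  ∷ u) = sel-∖ᵐ-disjoint m m′ u
  sel-∖ᵐ-disjoint (false ∷ m) (false ∷ m′) (_  ∷ u) = sel-∖ᵐ-disjoint m m′ u
  sel-∖ᵐ-disjoint (true  ∷ m) (false ∷ m′) (x∉ ∷ u) (here refl , q) = All.lookup x∉ (sel-⊆ _ (m′ ∖ᵐ m) q) refl
  sel-∖ᵐ-disjoint (true  ∷ m) (false ∷ m′) (_  ∷ u) (there p , q)   = sel-∖ᵐ-disjoint m m′ u (p , q)
  sel-∖ᵐ-disjoint (false ∷ m) (true  ∷ m′) (x∉ ∷ u) (p , here refl) = All.lookup x∉ (sel-⊆ _ (m ∖ᵐ m′) p) refl
  sel-∖ᵐ-disjoint (false ∷ m) (true  ∷ m′) (_  ∷ u) (p , there q)   = sel-∖ᵐ-disjoint m m′ u (p , q)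

sum-sel-≤ : ∀ xs (m : Mask xs) → sum (sel xs m) ≤ sum xs
sum-sel-≤ []       []          = z≤n
sum-sel-≤ (x ∷ xs) (true  ∷ m) = +-monoʳ-≤ x (sum-sel-≤ xs m)
sum-sel-≤ (x ∷ xs) (false ∷ m) = ≤-trans (sum-sel-≤ xs m) (m≤n+m (sum xs) x)

sum-sel-++ : ∀ xs {ys} (m : Mask xs) (n : Mask ys) →
             sum (sel (xs ++ ys) (All.++⁺ m n)) ≡ sum (sel xs m) + sum (sel ys n)
sum-sel-++ xs m n = trans (cong sum (sel-++ xs m n)) (sum-++ (sel xs m) _)

sum-sel-split : ∀ xs (m m′ : Mask xs) → sum (sel xs m) ≡ sum (sel xs (m ∖ᵐ m′)) + sum (sel xs (m ∩ᵐ m′))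
sum-sel-split []       []          []           = refl
sum-sel-split (x ∷ xs) (false ∷ m) (_     ∷ m′) = sum-sel-split xs m m′
sum-sel-split (x ∷ xs) (true  ∷ m) (false ∷ m′) =
  trans (cong (x +_) (sum-sel-split xs m m′)) (sym (+-assoc x _ _))
sum-sel-split (x ∷ xs) (true  ∷ m) (true  ∷ m′) = begin
  x + sum (sel xs m)        ≡⟨ cong (x +_) (sum-sel-split xs m m′) ⟩
  x + (d + c)               ≡⟨ sym (+-assoc x d c) ⟩
  x + d + c                 ≡⟨ cong (_+ c) (+-comm x d) ⟩
  d + x + c                 ≡⟨ +-assoc d x c ⟩
  d + (x + c)               ∎
  where
  open ≡-Reasoning
  d = sum (sel xs (m ∖ᵐ m′))
  c = sum (sel xs (m ∩ᵐ m′))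

sum-sel-split′ : ∀ xs (m m′ : Mask xs) → sum (sel xs m′) ≡ sum (sel xs (m′ ∖ᵐ m)) + sum (sel xs (m ∩ᵐ m′))
sum-sel-split′ xs m m′ =
  trans (sum-sel-split xs m′ m) (cong (λ k → sum (sel xs (m′ ∖ᵐ m)) + sum (sel xs k)) (∩ᵐ-comm m′ m))

sum-sel-∖ᵐ-≡ : ∀ xs (m m′ : Mask xs) → sum (sel xs m) ≡ sum (sel xs m′) →
               sum (sel xs (m ∖ᵐ m′)) ≡ sum (sel xs (m′ ∖ᵐ m))
sum-sel-∖ᵐ-≡ xs m m′ eq =
  +-cancelʳ-≡ (sum (sel xs (m ∩ᵐ m′))) _ _
    (trans (sym (sum-sel-split xs m m′)) (trans eq (sum-sel-split′ xs m m′)))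

sum-sel-≢⇒∖ᵐ-nonempty : ∀ xs (m m′ : Mask xs) → sum (sel xs m) ≢ sum (sel xs m′) →
                         ∃[ x ] (x ∈ sel xs (m ∖ᵐ m′) ⊎ x ∈ sel xs (m′ ∖ᵐ m))
sum-sel-≢⇒∖ᵐ-nonempty xs m m′ neq with sel xs (m ∖ᵐ m′) in e | sel xs (m′ ∖ᵐ m) in e′
... | x ∷ _ | _     = x , inj₁ (here refl)
... | []    | x ∷ _ = x , inj₂ (here refl)
... | []    | []    = ⊥-elim (neq (begin
  sum (sel xs m)                           ≡⟨ sum-sel-split xs m m′ ⟩
  sum (sel xs (m ∖ᵐ m′)) + c               ≡⟨ cong (λ ys → sum ys + c) (trans e (sym e′)) ⟩
  sum (sel xs (m′ ∖ᵐ m)) + c               ≡⟨ sym (sum-sel-split′ xs m m′) ⟩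
  sum (sel xs m′)                          ∎))
  where
  open ≡-Reasoning
  c = sum (sel xs (m ∩ᵐ m′))

∈-sublists⇒sel : ∀ xs {ys} → ys ∈ sublists xs → ∃[ m ] ys ≡ sel xs m
∈-sublists⇒sel []       (here refl) = [] , refl
∈-sublists⇒sel (x ∷ xs) p with ∈-++⁻ (sublists xs) p
... | inj₁ q with m , eq ← ∈-sublists⇒sel xs q = false ∷ m , eq
... | inj₂ q with ∈-map⁻ (x ∷_) q
...   | ys , q′ , refl with m , eq ← ∈-sublists⇒sel xs q′ = true ∷ m , cong (x ∷_) eq

∈-subsetSums⇒sel : ∀ xs {s} → s ∈ subsetSums xs → ∃[ m ] s ≡ sum (sel xs m)
∈-subsetSums⇒sel xs p
  with ∈-map⁻ sum (∈-deduplicate⁻ _≟_ (map sum (sublists xs)) p)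
... | ys , q , refl with m , refl ← ∈-sublists⇒sel xs q = m , refl

subsetSums-≤ : ∀ xs → All (_≤ sum xs) (subsetSums xs)
subsetSums-≤ xs = All.tabulate λ p → let m , eq = ∈-subsetSums⇒sel xs p in
  subst (_≤ sum xs) (sym eq) (sum-sel-≤ xs m)

lookup-injective : ∀ {a} {A : Set a} {xs : List A} → Unique xs → ∀ i j → lookup xs i ≡ lookup xs j → i ≡ j
lookup-injective (_  ∷ _) zero    zero    _  = refl
lookup-injective (x∉ ∷ _) zero    (suc j) eq = ⊥-elim (All.lookup x∉ (∈-lookup j) eq)
lookup-injective (x∉ ∷ _) (suc i) zero    eq = ⊥-elim (All.lookup x∉ (∈-lookup i) (sym eq))
lookup-injective (_  ∷ u) (suc i) (suc j) eq = cong suc (lookup-injective u i j eq)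

pigeonhole-≤ : ∀ {n N} → suc N < n → (g : Fin n → ℕ) → (∀ k → g k ≤ N) →
               ∃[ i ] ∃[ j ] (i ≢ j × g i ≡ g j)
pigeonhole-≤ N<n g g≤N with i , j , i<j , eq ← Fin.pigeonhole N<n (λ k → fromℕ< (s≤s (g≤N k))) =
  i , j , Fin.<⇒≢ i<j ,
  trans (sym (Fin.toℕ-fromℕ< (s≤s (g≤N i)))) (trans (cong toℕ eq) (Fin.toℕ-fromℕ< (s≤s (g≤N j))))

module _ (as bs : List ℕ) where

  private
    m n : ℕ
    m = length as
    n = length bs

  pairAt : Fin (m * n) → ℕ × ℕ
  pairAt k = Product.map (lookup as) (lookup bs) (remQuot {m} n k)

  pairAt-injective : Unique as → Unique bs → ∀ k l → pairAt k ≡ pairAt l → k ≡ l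
  pairAt-injective uas ubs k l eq = begin
    k                                     ≡⟨ sym (Fin.combine-remQuot {m} n k) ⟩
    uncurry combine (remQuot {m} n k)     ≡⟨ cong (uncurry combine) (cong₂ _,_
      (lookup-injective uas _ _ (cong proj₁ eq)) (lookup-injective ubs _ _ (cong proj₂ eq))) ⟩
    uncurry combine (remQuot {m} n l)     ≡⟨ Fin.combine-remQuot {m} n l ⟩
    l                                     ∎
    where open ≡-Reasoning

  sumset-pigeonhole : ∀ {p q} → Unique as → Unique bs → All (_≤ p) as → All (_≤ q) bs →
    suc (p + q) < m * n →
    ∃[ a₁ ] ∃[ a₂ ] ∃[ b₁ ] ∃[ b₂ ]
      (a₁ ∈ as × a₂ ∈ as × b₁ ∈ bs × b₂ ∈ bs × a₁ + b₁ ≡ a₂ + b₂ × b₁ ≢ b₂)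
  sumset-pigeonhole uas ubs as≤p bs≤q bound
    with k , l , k≢l , eq ← pigeonhole-≤ bound (λ k → uncurry _+_ (pairAt k))
           (λ k → +-mono-≤ (All.lookup as≤p (∈-lookup _)) (All.lookup bs≤q (∈-lookup _)))
    = _ , _ , _ , _ , ∈-lookup _ , ∈-lookup _ , ∈-lookup _ , ∈-lookup _ , eq , b₁≢b₂
    where
    b₁≢b₂ : proj₂ (pairAt k) ≢ proj₂ (pairAt l)
    b₁≢b₂ eq₂ = k≢l (pairAt-injective uas ubs k l
      (cong₂ _,_ (+-cancelʳ-≡ _ _ _ (trans eq (cong (_ +_) (sym eq₂)))) eq₂))

lemma4p4 : (B T : List ℕ) → Unique B → Unique T → Disjoint B T →
    card𝒮 B * card𝒮 T > sum B + sum T + 1 →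
    ∃[ X ] ∃[ Y ] (Unique X × Unique Y ×
      All (_∈ (B ++ T)) X × All (_∈ (B ++ T)) Y × Disjoint X Y ×
      sum X ≡ sum Y × ∃[ t ] (t ∈ T × (t ∈ X ⊎ t ∈ Y)))
lemma4p4 B T uB uT B#T bound
  with sumset-pigeonhole (subsetSums B) (subsetSums T) (deduplicate-! _) (deduplicate-! _)
         (subsetSums-≤ B) (subsetSums-≤ T) (subst (_< card𝒮 B * card𝒮 T) (+-comm _ 1) bound)
... | _ , _ , _ , _ , a₁∈ , a₂∈ , b₁∈ , b₂∈ , sums≡ , b₁≢b₂
  with ∈-subsetSums⇒sel B a₁∈ | ∈-subsetSums⇒sel B a₂∈ | ∈-subsetSums⇒sel T b₁∈ | ∈-subsetSums⇒sel T b₂∈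
... | mB₁ , refl | mB₂ , refl | mT₁ , refl | mT₂ , refl =
  sel I (M ∖ᵐ M′) , sel I (M′ ∖ᵐ M) , sel-unique _ uI , sel-unique _ uI ,
  All.tabulate (sel-⊆ I _) , All.tabulate (sel-⊆ I _) , sel-∖ᵐ-disjoint M M′ uI ,
  sum-sel-∖ᵐ-≡ I M M′ (trans (sum-sel-++ B mB₁ mT₁) (trans sums≡ (sym (sum-sel-++ B mB₂ mT₂)))) ,
  meets-T
  where
  I : List ℕ
  I = B ++ T
  M M′ : Mask I
  M  = All.++⁺ mB₁ mT₁
  M′ = All.++⁺ mB₂ mT₂
  uI : Unique I
  uI = Unique.++⁺ uB uT B#T
  meets-T : ∃[ t ] (t ∈ T × (t ∈ sel I (M ∖ᵐ M′) ⊎ t ∈ sel I (M′ ∖ᵐ M)))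
  meets-T with t , t∈ ← sum-sel-≢⇒∖ᵐ-nonempty T mT₁ mT₂ b₁≢b₂ =
    t , Sum.[ sel-⊆ T _ , sel-⊆ T _ ] t∈ ,
    Sum.map (∈-sel-∖ᵐ-++⁺ʳ B mB₁ mB₂ mT₁ mT₂) (∈-sel-∖ᵐ-++⁺ʳ B mB₂ mB₁ mT₂ mT₁) t∈
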